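{- Let $a$ be a positive integer. Then for every integer $n>12a$ there exists a prime number $p$ such that $n<ap<\frac{3n}{2}$. -}

module Defs where

-- With N = ⌊n / a⌋ it suffices to find, for every N ≥ 12, a prime p with N < p and 2p < 3N.
-- Below 80923 a ladder of primes 13, 19, 23, …, 80923, each less than 3/2 times the previous
-- one, provides it. Above, put r = ⌈N / 4⌉ and look for a prime in (4r, 6r − 5]. If there is
-- none, comparing valuations by Legendre's formula shows that B = C(6r, 2r) divides
--   ∏_{p ≤ √(6r)} p ^ ν_p(B) · ∏_{6r − 6 < p ≤ 6r} p · C(3r, r) · ∏_{p ≤ 6r/7} p,
-- where each p ^ ν_p(B) ≤ 6r. With 27^(2r) ≤ (4r + 1) 4^(2r) B and 4^r C(3r, r) ≤ 27^r this
-- gives 27^r ≤ 2^(3r + 2⌊6r/7⌋) once r ≥ 4^7, which is false since 27^7 > 2^33.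

module Submission where

open import Defs

open import Algebra.Properties.CommutativeSemigroup using (x∙yz≈y∙xz)
open import Data.Bool using (Bool; true; false; T; not; _∧_; _∨_)
open import Data.Bool.Properties using (T-∧; T-∨)
open import Data.Empty using (⊥)
open import Data.List using (List; []; _∷_)
open import Data.List.Relation.Unary.All using (All; []; _∷_)
open import Data.Nat
open import Data.Nat.Combinatorics using (_C_; nCk≡n!/k![n-k]!; k![n∸k]!∣n!)
open import Data.Nat.Divisibility
open import Data.Nat.DivMod
open import Data.Nat.Induction using (<-rec)
open import Data.Nat.ListAction using (product)
open import Data.Nat.Primality
open import Data.Nat.Primality.Factorisation using (factorise; module PrimeFactorisation)
open import Data.Nat.Properties
open import Data.Nat.Tactic.RingSolver using (solve-∀)
open import Data.Product using (∃; ∃-syntax; _×_; _,_)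
open import Data.Sum using (_⊎_; inj₁; inj₂; [_,_]′; map₂)
open import Function using (_∘_; Equivalence)
open import Relation.Binary.PropositionalEquality
open import Relation.Nullary using (¬_; yes; no; contradiction)
open import Relation.Nullary.Decidable using (Dec; toWitness; decidable-stable; _→-dec_; _×-dec_)

-- p-adic valuations

prime⇒1<p : ∀ {p} → Prime p → 1 < p
prime⇒1<p {p} pp = nonTrivial⇒n>1 p {{prime⇒nonTrivial pp}}

^-∣-mono : ∀ p {a b} → a ≤ b → p ^ a ∣ p ^ b
^-∣-mono p {a} {b} a≤b = divides (p ^ (b ∸ a)) (begin
  p ^ b               ≡⟨ cong (p ^_) (m+[n∸m]≡n a≤b) ⟨
  p ^ (a + (b ∸ a))   ≡⟨ ^-distribˡ-+-* p a (b ∸ a) ⟩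
  p ^ a * p ^ (b ∸ a) ≡⟨ *-comm (p ^ a) _ ⟩
  p ^ (b ∸ a) * p ^ a ∎)
  where open ≡-Reasoning

-- ν p x is the exponent of p in x when 1 < p and x ≠ 0; since every step divides x by p,
-- x steps of fuel suffice.
ν-fuel : ℕ → ℕ → ℕ → ℕ
ν-fuel zero       p x = 0
ν-fuel (suc fuel) p x with p ∣? x
... | yes (divides q _) = suc (ν-fuel fuel p q)
... | no  _             = 0

ν : ℕ → ℕ → ℕ
ν p x = ν-fuel x p x

^ν-fuel∣ : ∀ fuel p x → p ^ ν-fuel fuel p x ∣ x
^ν-fuel∣ zero       p x = 1∣ x
^ν-fuel∣ (suc fuel) p x with p ∣? x
... | yes (divides q refl) = subst (p * p ^ ν-fuel fuel p q ∣_) (*-comm p q) (*-monoʳ-∣ p (^ν-fuel∣ fuel p q))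
... | no  _                = 1∣ x

^[1+ν-fuel]∤ : ∀ fuel {p} x → 1 < p → .{{NonZero x}} → x ≤ fuel → p ^ suc (ν-fuel fuel p x) ∤ x
^[1+ν-fuel]∤ zero       x _ x≤0 = contradiction (n≤0⇒n≡0 x≤0) (≢-nonZero⁻¹ x)
^[1+ν-fuel]∤ (suc fuel) {p} x 1<p x≤1+fuel with p ∣? x
... | no  p∤x = λ p^1∣x → p∤x (m*n∣⇒m∣ p 1 p^1∣x)
... | yes (divides q refl) = λ p^[2+k]∣qp →
  ^[1+ν-fuel]∤ fuel q 1<p q≤fuel (*-cancelʳ-∣ p (subst (_∣ q * p) (*-comm p _) p^[2+k]∣qp))
  where
  instance
    _ = >-nonZero (<-trans z<s 1<p)
    _ = m*n≢0⇒m≢0 q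
  q≤fuel : q ≤ fuel
  q≤fuel = s≤s⁻¹ (<-≤-trans (m<m*n q p 1<p) x≤1+fuel)

^ν∣ : ∀ p x → p ^ ν p x ∣ x
^ν∣ p x = ^ν-fuel∣ x p x

^[1+ν]∤ : ∀ {p} x → 1 < p → .{{NonZero x}} → p ^ suc (ν p x) ∤ x
^[1+ν]∤ x 1<p = ^[1+ν-fuel]∤ x x 1<p ≤-refl

≤ν⇒^∣ : ∀ {p x e} → e ≤ ν p x → p ^ e ∣ x
≤ν⇒^∣ {p} {x} e≤ν = ∣-trans (^-∣-mono p e≤ν) (^ν∣ p x)

^∣⇒≤ν : ∀ {p x e} → 1 < p → .{{NonZero x}} → p ^ e ∣ x → e ≤ ν p x
^∣⇒≤ν {p} {x} {e} 1<p p^e∣x with e ≤? ν p x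
... | yes e≤ν = e≤ν
... | no  e≰ν = contradiction (∣-trans (^-∣-mono p (≰⇒> e≰ν)) p^e∣x) (^[1+ν]∤ x 1<p)

ν-mono-∣ : ∀ {p x y} → 1 < p → .{{NonZero y}} → x ∣ y → ν p x ≤ ν p y
ν-mono-∣ {p} {x} 1<p x∣y = ^∣⇒≤ν 1<p (∣-trans (^ν∣ p x) x∣y)

ν-unique : ∀ {p x e} → 1 < p → .{{NonZero x}} → p ^ e ∣ x → p ^ suc e ∤ x → ν p x ≡ e
ν-unique 1<p p^e∣x p^[1+e]∤x =
  ≤-antisym (≮⇒≥ (λ e<ν → p^[1+e]∤x (≤ν⇒^∣ e<ν))) (^∣⇒≤ν 1<p p^e∣x)

ν-* : ∀ {p} x y → Prime p → .{{NonZero x}} → .{{NonZero y}} → ν p (x * y) ≡ ν p x + ν p y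
ν-* {p} x y pp = ν-unique 1<p {{m*n≢0 x y}} p^[a+b]∣xy p^[1+a+b]∤xy
  where
  open ≡-Reasoning
  1<p = prime⇒1<p pp
  a = ν p x
  b = ν p y
  x′ = quotient (^ν∣ p x)
  y′ = quotient (^ν∣ p y)
  xy≡x′y′p^[a+b] : x * y ≡ (x′ * y′) * p ^ (a + b)
  xy≡x′y′p^[a+b] = begin
    x * y                       ≡⟨ cong₂ _*_ (m∣n⇒n≡quotient*m (^ν∣ p x)) (m∣n⇒n≡quotient*m (^ν∣ p y)) ⟩
    (x′ * p ^ a) * (y′ * p ^ b) ≡⟨ [m*n]*[o*p]≡[m*o]*[n*p] x′ (p ^ a) y′ (p ^ b) ⟩
    (x′ * y′) * (p ^ a * p ^ b) ≡⟨ cong (x′ * y′ *_) (^-distribˡ-+-* p a b) ⟨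
    (x′ * y′) * p ^ (a + b)     ∎
  p^[a+b]∣xy : p ^ (a + b) ∣ x * y
  p^[a+b]∣xy = divides (x′ * y′) xy≡x′y′p^[a+b]
  p∤quotient : ∀ z → .{{NonZero z}} → p ∤ quotient (^ν∣ p z)
  p∤quotient z p∣z′ = ^[1+ν]∤ z 1<p (subst (p * p ^ ν p z ∣_)
    (sym (m∣n⇒n≡quotient*m (^ν∣ p z))) (*-monoˡ-∣ (p ^ ν p z) p∣z′))
  p^[1+a+b]∤xy : p ^ suc (a + b) ∤ x * y
  p^[1+a+b]∤xy p^[1+a+b]∣xy with euclidsLemma x′ y′ pp
      (*-cancelʳ-∣ (p ^ (a + b)) {{m^n≢0 p (a + b) {{>-nonZero (<-trans z<s 1<p)}}}}
        (subst (p * p ^ (a + b) ∣_) xy≡x′y′p^[a+b] p^[1+a+b]∣xy))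
  ... | inj₁ p∣x′ = p∤quotient x p∣x′
  ... | inj₂ p∣y′ = p∤quotient y p∣y′

ν[1]≡0 : ∀ {p} → 1 < p → ν p 1 ≡ 0
ν[1]≡0 {p} 1<p = ν-unique 1<p (1∣ 1) (λ p^1∣1 → <⇒≢ 1<p (sym (∣1⇒≡1 (m*n∣⇒m∣ p 1 p^1∣1))))

ν[p^k]≡k : ∀ {p} k → 1 < p → ν p (p ^ k) ≡ k
ν[p^k]≡k {p} k 1<p = ν-unique 1<p {{p^k≢0}} ∣-refl p^[1+k]∤p^k
  where
  instance
    p≢0 = >-nonZero (<-trans z<s 1<p)
    p^k≢0 = m^n≢0 p k
  p^[1+k]∤p^k : p ^ suc k ∤ p ^ k
  p^[1+k]∤p^k p^[1+k]∣p^k =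
    <⇒≱ (subst (p ^ k <_) (*-comm (p ^ k) p) (m<m*n (p ^ k) p 1<p)) (∣⇒≤ p^[1+k]∣p^k)

ν[p]≡1 : ∀ {p} → 1 < p → ν p p ≡ 1
ν[p]≡1 {p} 1<p = trans (cong (ν p) (sym (*-identityʳ p))) (ν[p^k]≡k 1 1<p)

ν[q]≡0 : ∀ {p q} → Prime p → Prime q → p ≢ q → ν p q ≡ 0
ν[q]≡0 {p} {q} pp pq p≢q = ν-unique (prime⇒1<p pp) {{prime⇒nonZero pq}} (1∣ q) p^1∤q
  where
  p^1∤q : p ^ 1 ∤ q
  p^1∤q p^1∣q with prime⇒irreducible pq (m*n∣⇒m∣ p 1 p^1∣q)
  ... | inj₁ p≡1 = <⇒≢ (prime⇒1<p pp) (sym p≡1)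
  ... | inj₂ p≡q = p≢q p≡q

productOfPrimes-∣ : ∀ {ps} y → All Prime ps → .{{NonZero y}} →
                    (∀ {p} → Prime p → ν p (product ps) ≤ ν p y) → product ps ∣ y
productOfPrimes-∣ y [] _ = 1∣ y
productOfPrimes-∣ {p ∷ ps} y (pp ∷ pps) ν≤ =
  subst (p * product ps ∣_) (sym y≡py′) (*-monoʳ-∣ p (productOfPrimes-∣ y′ pps ν≤′))
  where
  instance
    _ = prime⇒nonZero pp
    _ = productOfPrimes≢0 pps
  1≤ν : 1 ≤ ν p y
  1≤ν = begin
    1                         ≡⟨ ν[p]≡1 (prime⇒1<p pp) ⟨
    ν p p                     ≤⟨ m≤m+n _ _ ⟩
    ν p p + ν p (product ps)  ≡⟨ ν-* p (product ps) pp ⟨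
    ν p (p * product ps)      ≤⟨ ν≤ pp ⟩
    ν p y                     ∎
    where open ≤-Reasoning
  p∣y : p ∣ y
  p∣y = m*n∣⇒m∣ p 1 (≤ν⇒^∣ 1≤ν)
  y′ = quotient p∣y
  y≡py′ : y ≡ p * y′
  y≡py′ = m∣n⇒n≡m*quotient p∣y
  instance _ = quotient≢0 p∣y
  ν≤′ : ∀ {q} → Prime q → ν q (product ps) ≤ ν q y′
  ν≤′ {q} pq = +-cancelˡ-≤ (ν q p) _ _ (subst₂ _≤_
    (ν-* p (product ps) pq) (trans (cong (ν q) y≡py′) (ν-* p y′ pq)) (ν≤ pq))

ν-≤⇒∣ : ∀ x y → .{{NonZero x}} → .{{NonZero y}} → (∀ {p} → Prime p → ν p x ≤ ν p y) → x ∣ y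
ν-≤⇒∣ x y ν≤ = subst (_∣ y) (sym isFactorisation)
  (productOfPrimes-∣ y factorsPrime (λ pp → subst (λ z → ν _ z ≤ _) isFactorisation (ν≤ pp)))
  where open PrimeFactorisation (factorise x)

m<[1+m/n]*n : ∀ m n .{{_ : NonZero n}} → m < suc (m / n) * n
m<[1+m/n]*n m n = subst (_< suc (m / n) * n) (sym (m≡m%n+[m/n]*n m n)) (+-monoˡ-< (m / n * n) (m%n<n m n))

/-unique : ∀ {m d q} .{{_ : NonZero d}} → q * d ≤ m → m < suc q * d → m / d ≡ q
/-unique {m} {d} {q} qd≤m m<[1+q]d = ≤-antisym
  (s≤s⁻¹ (*-cancelʳ-< d (m / d) (suc q) (≤-<-trans (m/n*n≤m m d) m<[1+q]d)))
  (s≤s⁻¹ (*-cancelʳ-< d q (suc (m / d)) (≤-<-trans qd≤m (m<[1+m/n]*n m d))))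

[1+n]/d≡n/d : ∀ {n d} .{{_ : NonZero d}} → d ∤ suc n → suc n / d ≡ n / d
[1+n]/d≡n/d {n} {d} d∤1+n = /-unique (≤-trans (m/n*n≤m n d) (n≤1+n n)) (begin-strict
  suc n                 ≡⟨ cong suc (m≡m%n+[m/n]*n n d) ⟩
  suc (n % d) + q * d   <⟨ +-monoˡ-< (q * d) 1+r<d ⟩
  d + q * d             ∎)
  where
  open ≤-Reasoning
  q = n / d
  1+r<d : suc (n % d) < d
  1+r<d with m≤n⇒m<n∨m≡n (m%n<n n d)
  ... | inj₁ 1+r<d = 1+r<d
  ... | inj₂ 1+r≡d = contradiction (divides (suc q) (begin-equality
    suc n               ≡⟨ cong suc (m≡m%n+[m/n]*n n d) ⟩
    suc (n % d) + q * d ≡⟨ cong (_+ q * d) 1+r≡d ⟩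
    d + q * d           ∎)) d∤1+n

[1+n]/d≡1+n/d : ∀ {n d} .{{_ : NonZero d}} → d ∣ suc n → suc n / d ≡ suc (n / d)
[1+n]/d≡1+n/d {n} {d} (divides (suc k) 1+n≡[1+k]d) = begin-equality
  suc n / d       ≡⟨ /-congˡ 1+n≡[1+k]d ⟩
  suc k * d / d   ≡⟨ m*n/n≡m (suc k) d ⟩
  suc k           ≡⟨ cong suc (/-unique kd≤n (≤-reflexive 1+n≡[1+k]d)) ⟨
  suc (n / d)     ∎
  where
  open ≤-Reasoning
  kd≤n : k * d ≤ n
  kd≤n = s≤s⁻¹ (begin-strict
    k * d        <⟨ m<n+m (k * d) (>-nonZero⁻¹ d) ⟩
    d + k * d    ≡⟨ 1+n≡[1+k]d ⟨
    suc n        ∎)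
[1+n]/d≡1+n/d {n} {d} (divides zero ())

m*n≤o⇒m≤o/n : ∀ m {n o} .{{_ : NonZero n}} → m * n ≤ o → m ≤ o / n
m*n≤o⇒m≤o/n m {n} mn≤o = subst (_≤ _) (m*n/n≡m m n) (/-monoˡ-≤ n mn≤o)

[k*m]/n/k≡m/n : ∀ k m n .{{_ : NonZero k}} .{{_ : NonZero n}} → k * m / n / k ≡ m / n
[k*m]/n/k≡m/n k m n = begin
  k * m / n / k       ≡⟨ m/n/o≡m/[n*o] (k * m) n k ⟩
  k * m / (n * k)     ≡⟨ /-congʳ (*-comm n k) ⟩
  k * m / (k * n)     ≡⟨ m*n/m*o≡n/o k m n ⟩
  m / n               ∎
  where
  open ≡-Reasoning
  instance
    _ = m*n≢0 n k
    _ = m*n≢0 k n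

[m+n]/d≤m/d+n/d+1 : ∀ m n d .{{_ : NonZero d}} → (m + n) / d ≤ m / d + n / d + 1
[m+n]/d≤m/d+n/d+1 m n d = s≤s⁻¹ (subst ((m + n) / d <_) (trans (+-comm 2 _) (+-suc _ 1)) (m<n*o⇒m/o<n (begin-strict
  m + n                                <⟨ +-mono-< (m<[1+m/n]*n m d) (m<[1+m/n]*n n d) ⟩
  suc (m / d) * d + suc (n / d) * d    ≡⟨ *-distribʳ-+ d (suc (m / d)) (suc (n / d)) ⟨
  (suc (m / d) + suc (n / d)) * d      ≡⟨ cong (_* d) (+-suc (suc (m / d)) (n / d)) ⟩
  (2 + (m / d + n / d)) * d            ∎)))
  where open ≤-Reasoning

-- Legendre's formula

C-factorial : ∀ a b → ((a + b) C a) * (a ! * b !) ≡ (a + b) !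
C-factorial a b = begin
  ((a + b) C a) * (a ! * b !)            ≡⟨ cong (λ c → ((a + b) C a) * (a ! * c !)) (m+n∸m≡n a b) ⟨
  ((a + b) C a) * (a ! * (a + b ∸ a) !)  ≡⟨ cong (_* (a ! * (a + b ∸ a) !)) (nCk≡n!/k![n-k]! a≤a+b) ⟩
  (a + b) ! / d * d                      ≡⟨ m/n*n≡m (k![n∸k]!∣n! a≤a+b) ⟩
  (a + b) !                              ∎
  where
  open ≡-Reasoning
  a≤a+b = m≤m+n a b
  d = a ! * (a + b ∸ a) !
  instance _ = a !* (a + b ∸ a) !≢0

C≢0 : ∀ a b → NonZero ((a + b) C a)
C≢0 a b = m*n≢0⇒m≢0 ((a + b) C a) {n = a ! * b !}
  {{subst NonZero (sym (C-factorial a b)) ((a + b) !≢0)}}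

module _ {p : ℕ} (pp : Prime p) where
  private
    instance _ = prime⇒nonZero pp
    1<p = prime⇒1<p pp

  infixl 7 _/p^_
  _/p^_ : ℕ → ℕ → ℕ
  n /p^ j = (n / p ^ j) {{m^n≢0 p j}}

  legendreSum : ℕ → ℕ → ℕ
  legendreSum zero    n = 0
  legendreSum (suc J) n = legendreSum J n + n /p^ suc J

  [1+n]/p^[1+J] : ∀ J n → J ⊓ ν p (suc n) + suc n /p^ suc J ≡ n /p^ suc J + suc J ⊓ ν p (suc n)
  [1+n]/p^[1+J] J n = [ ν≥1+J , ν<1+J ]′ (≤-<-connex (suc J) (ν p (suc n)))
    where
    open ≡-Reasoning
    instance _ = m^n≢0 p (suc J)
    ν≥1+J : suc J ≤ ν p (suc n) → _
    ν≥1+J 1+J≤ν = begin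
      J ⊓ ν p (suc n) + suc n /p^ suc J
        ≡⟨ cong₂ _+_ (m≤n⇒m⊓n≡m (<⇒≤ 1+J≤ν)) ([1+n]/d≡1+n/d (≤ν⇒^∣ 1+J≤ν)) ⟩
      J + suc (n /p^ suc J)
        ≡⟨ trans (+-suc J _) (+-comm (suc J) _) ⟩
      n /p^ suc J + suc J
        ≡⟨ cong (n /p^ suc J +_) (m≤n⇒m⊓n≡m 1+J≤ν) ⟨
      n /p^ suc J + suc J ⊓ ν p (suc n)
        ∎
    ν<1+J : ν p (suc n) < suc J → _
    ν<1+J ν<1+J = begin
      J ⊓ ν p (suc n) + suc n /p^ suc J
        ≡⟨ cong₂ _+_ (m≥n⇒m⊓n≡n (s≤s⁻¹ ν<1+J)) ([1+n]/d≡n/d (<⇒≱ ν<1+J ∘ ^∣⇒≤ν 1<p)) ⟩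
      ν p (suc n) + n /p^ suc J
        ≡⟨ +-comm (ν p (suc n)) _ ⟩
      n /p^ suc J + ν p (suc n)
        ≡⟨ cong (n /p^ suc J +_) (m≥n⇒m⊓n≡n (<⇒≤ ν<1+J)) ⟨
      n /p^ suc J + suc J ⊓ ν p (suc n)
        ∎

  legendreSum-suc : ∀ J n → legendreSum J (suc n) ≡ legendreSum J n + J ⊓ ν p (suc n)
  legendreSum-suc zero    n = refl
  legendreSum-suc (suc J) n = begin
    legendreSum J (suc n) + suc n /p^ suc J          ≡⟨ cong (_+ suc n /p^ suc J) (legendreSum-suc J n) ⟩
    legendreSum J n + J ⊓ e + suc n /p^ suc J        ≡⟨ +-assoc (legendreSum J n) _ _ ⟩
    legendreSum J n + (J ⊓ e + suc n /p^ suc J)      ≡⟨ cong (legendreSum J n +_) ([1+n]/p^[1+J] J n) ⟩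
    legendreSum J n + (n /p^ suc J + suc J ⊓ e)      ≡⟨ +-assoc (legendreSum J n) _ _ ⟨
    legendreSum J n + n /p^ suc J + suc J ⊓ e        ∎
    where
    open ≡-Reasoning
    e = ν p (suc n)

  legendre : ∀ J n → n < p ^ suc J → ν p (n !) ≡ legendreSum J n
  legendre J zero    _ = trans (ν[1]≡0 1<p) (sym (legendreSum[0] J))
    where
    legendreSum[0] : ∀ J → legendreSum J 0 ≡ 0
    legendreSum[0] zero    = refl
    legendreSum[0] (suc J) = cong₂ _+_ (legendreSum[0] J) (0/n≡0 (p ^ suc J) {{m^n≢0 p (suc J)}})
  legendre J (suc n) 1+n<p^[1+J] = begin
    ν p (suc n * n !)                  ≡⟨ ν-* (suc n) (n !) pp {{_}} {{n !≢0}} ⟩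
    ν p (suc n) + ν p (n !)            ≡⟨ +-comm (ν p (suc n)) _ ⟩
    ν p (n !) + ν p (suc n)            ≡⟨ cong (_+ ν p (suc n)) (legendre J n (<-trans (n<1+n n) 1+n<p^[1+J])) ⟩
    legendreSum J n + ν p (suc n)      ≡⟨ cong (legendreSum J n +_) (m≥n⇒m⊓n≡n ν≤J) ⟨
    legendreSum J n + J ⊓ ν p (suc n)  ≡⟨ legendreSum-suc J n ⟨
    legendreSum J (suc n)              ∎
    where
    open ≡-Reasoning
    ν≤J : ν p (suc n) ≤ J
    ν≤J = ≮⇒≥ (λ J<ν → <⇒≱ (≤-<-trans (∣⇒≤ (^ν∣ p (suc n))) 1+n<p^[1+J]) (^-monoʳ-≤ p J<ν))

  legendreSum-+ : ∀ J a b → legendreSum J (a + b) ≤ legendreSum J a + legendreSum J b + J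
  legendreSum-+ zero    a b = z≤n
  legendreSum-+ (suc J) a b = begin
    legendreSum J (a + b) + (a + b) /p^ suc J
      ≤⟨ +-mono-≤ (legendreSum-+ J a b) ([m+n]/d≤m/d+n/d+1 a b (p ^ suc J) {{m^n≢0 p (suc J)}}) ⟩
    (legendreSum J a + legendreSum J b + J) + (a /p^ suc J + b /p^ suc J + 1)
      ≡⟨ rearrange (legendreSum J a) (legendreSum J b) J (a /p^ suc J) (b /p^ suc J) ⟩
    (legendreSum J a + a /p^ suc J) + (legendreSum J b + b /p^ suc J) + suc J ∎
    where
    open ≤-Reasoning
    rearrange : ∀ sa sb j da db → sa + sb + j + (da + db + 1) ≡ (sa + da) + (sb + db) + suc j
    rearrange = solve-∀

  ν-C : ∀ (f : ℕ → ℕ) a b → (∀ {x} → x ≤ a + b → ν p (x !) ≡ f x) →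
        ν p ((a + b) C a) + (f a + f b) ≡ f (a + b)
  ν-C f a b ν[x!]≡f = begin
    νC + (f a + f b)                    ≡⟨ cong (νC +_) (cong₂ _+_ (ν[x!]≡f (m≤m+n a b)) (ν[x!]≡f (m≤n+m b a))) ⟨
    νC + (ν p (a !) + ν p (b !))        ≡⟨ cong (νC +_) (ν-* (a !) (b !) pp {{a !≢0}} {{b !≢0}}) ⟨
    νC + ν p (a ! * b !)                ≡⟨ ν-* ((a + b) C a) (a ! * b !) pp {{C≢0 a b}} {{a !* b !≢0}} ⟨
    ν p (((a + b) C a) * (a ! * b !))   ≡⟨ cong (ν p) (C-factorial a b) ⟩
    ν p ((a + b) !)                     ≡⟨ ν[x!]≡f ≤-refl ⟩
    f (a + b)                           ∎
    where
    open ≡-Reasoning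
    νC = ν p ((a + b) C a)

  ν-C-≤ : ∀ {L} a b → a + b < p ^ suc L → ν p ((a + b) C a) ≤ L
  ν-C-≤ {L} a b a+b<p^[1+L] = +-cancelʳ-≤ (legendreSum L a + legendreSum L b) _ L (begin
    ν p ((a + b) C a) + (legendreSum L a + legendreSum L b)  ≡⟨ ν-C (legendreSum L) a b legendre′ ⟩
    legendreSum L (a + b)                                    ≤⟨ legendreSum-+ L a b ⟩
    legendreSum L a + legendreSum L b + L                    ≡⟨ +-comm _ L ⟩
    L + (legendreSum L a + legendreSum L b)                  ∎)
    where
    open ≤-Reasoning
    legendre′ : ∀ {x} → x ≤ a + b → ν p (x !) ≡ legendreSum L x
    legendre′ {x} x≤a+b = legendre L x (≤-<-trans x≤a+b a+b<p^[1+L])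

  p^ν[C]≤ : ∀ a b → 0 < a + b → p ^ ν p ((a + b) C a) ≤ a + b
  p^ν[C]≤ a b 0<a+b with ν p ((a + b) C a) in eq
  ... | zero  = 0<a+b
  ... | suc L = ≮⇒≥ (λ a+b<p^[1+L] → <-irrefl refl (subst (_≤ L) eq (ν-C-≤ a b a+b<p^[1+L])))

  ν-C≡0 : ∀ a b → a + b < p → ν p ((a + b) C a) ≡ 0
  ν-C≡0 a b a+b<p = m+n≡0⇒m≡0 _ (ν-C (λ _ → 0) a b legendre′)
    where
    legendre′ : ∀ {x} → x ≤ a + b → ν p (x !) ≡ 0
    legendre′ {x} x≤a+b = legendre 0 x (subst (x <_) (sym (*-identityʳ p)) (≤-<-trans x≤a+b a+b<p))

  ν-C-large : ∀ a b → a + b < p * p → ν p ((a + b) C a) + (a / p + b / p) ≡ (a + b) / p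
  ν-C-large a b a+b<p² = ν-C (_/ p) a b legendre′
    where
    legendre′ : ∀ {x} → x ≤ a + b → ν p (x !) ≡ x / p
    legendre′ {x} x≤a+b = trans
      (legendre 1 x (subst (x <_) (cong (p *_) (sym (*-identityʳ p))) (≤-<-trans x≤a+b a+b<p²)))
      (/-congʳ {{m^n≢0 p 1}} (*-identityʳ p))

  ν-C-large≤1 : ∀ a b → a + b < p * p → ν p ((a + b) C a) ≤ 1
  ν-C-large≤1 a b a+b<p² = +-cancelʳ-≤ (a / p + b / p) _ 1 (begin
    ν p ((a + b) C a) + (a / p + b / p)  ≡⟨ ν-C-large a b a+b<p² ⟩
    (a + b) / p                          ≤⟨ [m+n]/d≤m/d+n/d+1 a b p ⟩
    a / p + b / p + 1                    ≡⟨ +-comm _ 1 ⟩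
    1 + (a / p + b / p)                  ∎)
    where open ≤-Reasoning

  ν-C-middle≥1 : ∀ a b → a < p → b < p → p ≤ a + b → 1 ≤ ν p ((a + b) C a)
  ν-C-middle≥1 a b a<p b<p p≤a+b = begin
    1                                     ≤⟨ m≥n⇒m/n>0 p≤a+b ⟩
    (a + b) / p                           ≡⟨ ν-C-large a b a+b<p² ⟨
    ν p ((a + b) C a) + (a / p + b / p)   ≡⟨ cong (ν p ((a + b) C a) +_) (cong₂ _+_ (m<n⇒m/n≡0 a<p) (m<n⇒m/n≡0 b<p)) ⟩
    ν p ((a + b) C a) + 0                 ≡⟨ +-identityʳ _ ⟩
    ν p ((a + b) C a)                     ∎
    where
    open ≤-Reasoning
    a+b<p² : a + b < p * p
    a+b<p² = <-≤-trans (+-mono-< a<p b<p) (subst (_≤ p * p) (cong (p +_) (+-identityʳ p)) (*-monoˡ-≤ p 1<p))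

-- Growth of binomial coefficients

C[2k+1,k]-rec : ∀ k → ((suc k + suc (suc k)) C suc k) * (2 + k) ≡ (4 * k + 6) * ((k + suc k) C k)
C[2k+1,k]-rec k = *-cancelʳ-≡ _ _ F {{F≢0}} (begin
  C₁ * (2 + k) * F                                   ≡⟨ lhs C₁ k f ⟩
  C₁ * ((suc k) ! * (suc (suc k)) !)                 ≡⟨ C-factorial (suc k) (suc (suc k)) ⟩
  (suc k + suc (suc k)) !                            ≡⟨ cong _! (index k) ⟩
  (2 + n) * ((1 + n) * n !)                          ≡⟨ cong (λ x → (2 + n) * ((1 + n) * x)) (C-factorial k (suc k)) ⟨
  (2 + n) * ((1 + n) * (C₀ * (k ! * (suc k) !)))     ≡⟨ rhs C₀ k f ⟩
  (4 * k + 6) * C₀ * F                               ∎)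
  where
  open ≡-Reasoning
  n = k + suc k
  f = k !
  C₀ = (k + suc k) C k
  C₁ = (suc k + suc (suc k)) C suc k
  F = suc k * (suc k * (f * f))
  F≢0 : NonZero F
  F≢0 = m*n≢0 (suc k) _ {{_}} {{m*n≢0 (suc k) _ {{_}} {{m*n≢0 f f {{k !≢0}} {{k !≢0}}}}}}
  index : ∀ k → suc k + suc (suc k) ≡ 2 + (k + suc k)
  index = solve-∀
  lhs : ∀ C₁ k f → C₁ * (2 + k) * (suc k * (suc k * (f * f)))
                  ≡ C₁ * ((suc k * f) * ((2 + k) * (suc k * f)))
  lhs = solve-∀
  rhs : ∀ C₀ k f → (2 + (k + suc k)) * ((1 + (k + suc k)) * (C₀ * (f * (suc k * f))))
                  ≡ (4 * k + 6) * C₀ * (suc k * (suc k * (f * f)))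
  rhs = solve-∀

C[2k+1,k]≤4^k : ∀ k → (k + suc k) C k ≤ 4 ^ k
C[2k+1,k]≤4^k zero    = ≤-refl
C[2k+1,k]≤4^k (suc k) = *-cancelʳ-≤ _ _ (2 + k) (begin
  ((suc k + suc (suc k)) C suc k) * (2 + k) ≡⟨ C[2k+1,k]-rec k ⟩
  (4 * k + 6) * ((k + suc k) C k)           ≤⟨ *-mono-≤ (+-monoʳ-≤ (4 * k) (m≤m+n 6 2)) (C[2k+1,k]≤4^k k) ⟩
  (4 * k + 8) * 4 ^ k                       ≡⟨ reassoc k (4 ^ k) ⟩
  4 ^ suc k * (2 + k)                       ∎)
  where
  open ≤-Reasoning
  reassoc : ∀ k x → (4 * k + 8) * x ≡ 4 * x * (2 + k)
  reassoc = solve-∀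

C[3m,m]-rec : ∀ m → ((suc m + 2 * suc m) C suc m) * (2 * suc m * suc (2 * m))
                    ≡ (3 * (3 * m + 1) * (3 * m + 2)) * ((m + 2 * m) C m)
C[3m,m]-rec m = *-cancelʳ-≡ _ _ F {{F≢0}} (begin
  C₁ * (2 * suc m * suc (2 * m)) * F                    ≡⟨ lhs C₁ m f g ⟩
  C₁ * ((suc m) ! * (2 + 2 * m) !)                      ≡⟨ cong (λ x → C₁ * ((suc m) ! * x !)) (index₂ m) ⟨
  C₁ * ((suc m) ! * (2 * suc m) !)                      ≡⟨ C-factorial (suc m) (2 * suc m) ⟩
  (suc m + 2 * suc m) !                                 ≡⟨ cong _! (index₃ m) ⟩
  (3 + n) * ((2 + n) * ((1 + n) * n !))
    ≡⟨ cong (λ x → (3 + n) * ((2 + n) * ((1 + n) * x))) (C-factorial m (2 * m)) ⟨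
  (3 + n) * ((2 + n) * ((1 + n) * (C₀ * (f * g))))      ≡⟨ rhs C₀ m f g ⟩
  (3 * (3 * m + 1) * (3 * m + 2)) * C₀ * F              ∎)
  where
  open ≡-Reasoning
  n = m + 2 * m
  f = m !
  g = (2 * m) !
  C₀ = (m + 2 * m) C m
  C₁ = (suc m + 2 * suc m) C suc m
  F = suc m * (f * g)
  F≢0 : NonZero F
  F≢0 = m*n≢0 (suc m) _ {{_}} {{m*n≢0 f g {{m !≢0}} {{(2 * m) !≢0}}}}
  index₂ : ∀ m → 2 * suc m ≡ 2 + 2 * m
  index₂ = solve-∀
  index₃ : ∀ m → suc m + 2 * suc m ≡ 3 + (m + 2 * m)
  index₃ = solve-∀
  lhs : ∀ C₁ m f g → C₁ * (2 * suc m * suc (2 * m)) * (suc m * (f * g))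
                     ≡ C₁ * ((suc m * f) * ((2 + 2 * m) * ((1 + 2 * m) * g)))
  lhs = solve-∀
  rhs : ∀ C₀ m f g → (3 + (m + 2 * m)) * ((2 + (m + 2 * m)) * ((1 + (m + 2 * m)) * (C₀ * (f * g))))
                    ≡ (3 * (3 * m + 1) * (3 * m + 2)) * C₀ * (suc m * (f * g))
  rhs = solve-∀

4^m*C[3m,m]≤27^m : ∀ m → 4 ^ m * ((m + 2 * m) C m) ≤ 27 ^ m
4^m*C[3m,m]≤27^m zero    = ≤-refl
4^m*C[3m,m]≤27^m (suc m) = *-cancelʳ-≤ _ _ Z {{Z≢0}} (begin
  4 * 4 ^ m * C₁ * Z        ≡⟨ *-assoc (4 * 4 ^ m) C₁ Z ⟩
  4 * 4 ^ m * (C₁ * Z)      ≡⟨ cong (4 * 4 ^ m *_) (C[3m,m]-rec m) ⟩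
  4 * 4 ^ m * (c * C₀)      ≡⟨ regroup (4 ^ m) C₀ c ⟩
  4 * c * (4 ^ m * C₀)      ≤⟨ *-mono-≤ 4c≤27Z (4^m*C[3m,m]≤27^m m) ⟩
  27 * Z * 27 ^ m           ≡⟨ regroup′ Z (27 ^ m) ⟩
  27 * 27 ^ m * Z           ∎)
  where
  open ≤-Reasoning
  C₀ = (m + 2 * m) C m
  C₁ = (suc m + 2 * suc m) C suc m
  Z = 2 * suc m * suc (2 * m)
  c = 3 * (3 * m + 1) * (3 * m + 2)
  Z≢0 : NonZero Z
  Z≢0 = m*n≢0 (2 * suc m) (suc (2 * m))
  slack : ∀ m → 27 * (2 * suc m * suc (2 * m)) ≡ 4 * (3 * (3 * m + 1) * (3 * m + 2)) + (54 * m + 30)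
  slack = solve-∀
  4c≤27Z : 4 * c ≤ 27 * Z
  4c≤27Z = subst (4 * c ≤_) (sym (slack m)) (m≤m+n (4 * c) _)
  regroup : ∀ x t c → 4 * x * (c * t) ≡ 4 * c * (x * t)
  regroup = solve-∀
  regroup′ : ∀ z y → 27 * z * y ≡ 27 * y * z
  regroup′ = solve-∀

27^m≤[2m+1]*4^m*C[3m,m] : ∀ m → 27 ^ m ≤ (2 * m + 1) * (4 ^ m * ((m + 2 * m) C m))
27^m≤[2m+1]*4^m*C[3m,m] zero    = ≤-refl
27^m≤[2m+1]*4^m*C[3m,m] (suc m) = *-cancelʳ-≤ _ _ Z {{Z≢0}} (begin
  27 * 27 ^ m * Z                                 ≡⟨ regroup₁ (27 ^ m) Z ⟩
  27 * Z * 27 ^ m                                 ≤⟨ *-monoʳ-≤ (27 * Z) (27^m≤[2m+1]*4^m*C[3m,m] m) ⟩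
  27 * Z * ((2 * m + 1) * (4 ^ m * C₀))          ≡⟨ *-assoc (27 * Z) (2 * m + 1) _ ⟨
  27 * Z * (2 * m + 1) * (4 ^ m * C₀)            ≤⟨ *-monoˡ-≤ (4 ^ m * C₀) 27Z[2m+1]≤4[2m+3]c ⟩
  4 * (2 * m + 3) * c * (4 ^ m * C₀)             ≡⟨ regroup₂ m c (4 ^ m) C₀ ⟩
  (2 * suc m + 1) * (4 * 4 ^ m) * (c * C₀)       ≡⟨ cong ((2 * suc m + 1) * (4 * 4 ^ m) *_) (C[3m,m]-rec m) ⟨
  (2 * suc m + 1) * (4 * 4 ^ m) * (C₁ * Z)       ≡⟨ regroup₃ (2 * suc m + 1) (4 * 4 ^ m) C₁ Z ⟩
  (2 * suc m + 1) * (4 * 4 ^ m * C₁) * Z         ∎)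
  where
  open ≤-Reasoning
  C₀ = (m + 2 * m) C m
  C₁ = (suc m + 2 * suc m) C suc m
  Z = 2 * suc m * suc (2 * m)
  c = 3 * (3 * m + 1) * (3 * m + 2)
  Z≢0 : NonZero Z
  Z≢0 = m*n≢0 (2 * suc m) (suc (2 * m))
  slack : ∀ m → 4 * (2 * m + 3) * (3 * (3 * m + 1) * (3 * m + 2))
                ≡ 27 * (2 * suc m * suc (2 * m)) * (2 * m + 1) + (108 * m * m + 102 * m + 18)
  slack = solve-∀
  27Z[2m+1]≤4[2m+3]c : 27 * Z * (2 * m + 1) ≤ 4 * (2 * m + 3) * c
  27Z[2m+1]≤4[2m+3]c = subst (27 * Z * (2 * m + 1) ≤_) (sym (slack m)) (m≤m+n _ _)
  regroup₁ : ∀ y z → 27 * y * z ≡ 27 * z * y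
  regroup₁ = solve-∀
  regroup₂ : ∀ m c x t → 4 * (2 * m + 3) * c * (x * t) ≡ (2 * suc m + 1) * (4 * x) * (c * t)
  regroup₂ = solve-∀
  regroup₃ : ∀ a b t z → a * b * (t * z) ≡ a * (b * t) * z
  regroup₃ = solve-∀

-- Products of primes

primeOr1 : ℕ → ℕ
primeOr1 q with prime? q
... | yes _ = q
... | no  _ = 1

primeOr1-prime : ∀ {p} → Prime p → primeOr1 p ≡ p
primeOr1-prime {p} pp with prime? p
... | yes _   = refl
... | no  ¬pp = contradiction pp ¬pp

primeOr1≢0 : ∀ q → NonZero (primeOr1 q)
primeOr1≢0 q with prime? q
... | yes pq = prime⇒nonZero pq
... | no  _  = _

primeOr1≤ : ∀ q → 0 < q → primeOr1 q ≤ q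
primeOr1≤ q 0<q with prime? q
... | yes _ = ≤-refl
... | no  _ = 0<q

primeOr1[m+m]≤2 : ∀ m → primeOr1 (m + m) ≤ 2
primeOr1[m+m]≤2 m with prime? (m + m)
... | no  _ = s≤s z≤n
... | yes pm+m with prime⇒irreducible pm+m (divides m (trans (cong (m +_) (sym (+-identityʳ m))) (*-comm 2 m)))
...   | inj₁ ()
...   | inj₂ 2≡m+m = ≤-reflexive (sym 2≡m+m)

primeProduct : ℕ → ℕ → ℕ
primeProduct a zero    = 1
primeProduct a (suc k) = primeProduct a k * primeOr1 (a + suc k)

primeProduct≢0 : ∀ a k → NonZero (primeProduct a k)
primeProduct≢0 a zero    = _
primeProduct≢0 a (suc k) = m*n≢0 _ _ {{primeProduct≢0 a k}} {{primeOr1≢0 (a + suc k)}}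

primeProduct≤ : ∀ a k → primeProduct a k ≤ (a + k) ^ k
primeProduct≤ a zero    = ≤-refl
primeProduct≤ a (suc k) = begin
  primeProduct a k * primeOr1 (a + suc k)  ≤⟨ *-mono-≤ (primeProduct≤ a k) (primeOr1≤ (a + suc k) 0<a+1+k) ⟩
  (a + k) ^ k * (a + suc k)                ≤⟨ *-monoˡ-≤ (a + suc k) (^-monoˡ-≤ k (+-monoʳ-≤ a (n≤1+n k))) ⟩
  (a + suc k) ^ k * (a + suc k)            ≡⟨ *-comm _ (a + suc k) ⟩
  (a + suc k) ^ suc k                      ∎
  where
  open ≤-Reasoning
  0<a+1+k = ≤-trans (s≤s z≤n) (m≤n+m (suc k) a)

primeProduct-+ : ∀ a k → primeProduct 0 (a + k) ≡ primeProduct 0 a * primeProduct a k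
primeProduct-+ a zero    = trans (cong (primeProduct 0) (+-identityʳ a)) (sym (*-identityʳ _))
primeProduct-+ a (suc k) = begin
  primeProduct 0 (a + suc k)                                  ≡⟨ cong (primeProduct 0) (+-suc a k) ⟩
  primeProduct 0 (a + k) * primeOr1 (suc (a + k))
    ≡⟨ cong₂ _*_ (primeProduct-+ a k) (cong primeOr1 (sym (+-suc a k))) ⟩
  primeProduct 0 a * primeProduct a k * primeOr1 (a + suc k)  ≡⟨ *-assoc (primeProduct 0 a) _ _ ⟩
  primeProduct 0 a * primeProduct a (suc k)                   ∎
  where open ≡-Reasoning

primePowerPart : ℕ → ℕ → ℕ
primePowerPart zero    x = 1
primePowerPart (suc q) x = primePowerPart q x * primeOr1 (suc q) ^ ν (suc q) x

primePowerPart≢0 : ∀ s x → NonZero (primePowerPart s x)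
primePowerPart≢0 zero    x = _
primePowerPart≢0 (suc q) x =
  m*n≢0 _ _ {{primePowerPart≢0 q x}} {{m^n≢0 (primeOr1 (suc q)) (ν (suc q) x) {{primeOr1≢0 (suc q)}}}}

primePowerPart≤ : ∀ s x {X} → 0 < X → (∀ {q} → Prime q → q ^ ν q x ≤ X) → primePowerPart s x ≤ X ^ s
primePowerPart≤ zero    x _   _     = ≤-refl
primePowerPart≤ (suc q) x {X} 0<X bound = begin
  primePowerPart q x * primeOr1 (suc q) ^ ν (suc q) x  ≤⟨ *-mono-≤ (primePowerPart≤ q x 0<X bound) factor≤X ⟩
  X ^ q * X                                            ≡⟨ *-comm (X ^ q) X ⟩
  X ^ suc q                                            ∎
  where
  open ≤-Reasoning
  factor≤X : primeOr1 (suc q) ^ ν (suc q) x ≤ X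
  factor≤X with prime? (suc q)
  ... | yes p = bound p
  ... | no  _ = subst (_≤ X) (sym (^-zeroˡ (ν (suc q) x))) 0<X

module _ {p : ℕ} (pp : Prime p) where
  private 1<p = prime⇒1<p pp

  ν-primeOr1-≢ : ∀ {q} → q ≢ p → ν p (primeOr1 q) ≡ 0
  ν-primeOr1-≢ {q} q≢p with prime? q
  ... | yes pq = ν[q]≡0 pp pq (q≢p ∘ sym)
  ... | no  _  = ν[1]≡0 1<p

  ν-primeProduct-suc : ∀ a k →
    ν p (primeProduct a (suc k)) ≡ ν p (primeProduct a k) + ν p (primeOr1 (a + suc k))
  ν-primeProduct-suc a k = ν-* _ _ pp {{primeProduct≢0 a k}} {{primeOr1≢0 (a + suc k)}}

  ν-primeProduct-outside : ∀ a k → p ≤ a ⊎ a + k < p → ν p (primeProduct a k) ≡ 0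
  ν-primeProduct-outside a zero    _   = ν[1]≡0 1<p
  ν-primeProduct-outside a (suc k) out = trans (ν-primeProduct-suc a k)
    (cong₂ _+_ (ν-primeProduct-outside a k (map₂ (<-trans (+-monoʳ-< a (n<1+n k))) out)) (ν-primeOr1-≢ a+1+k≢p))
    where
    a+1+k≢p : a + suc k ≢ p
    a+1+k≢p refl = [ <⇒≱ (m<m+n a z<s) , <-irrefl refl ]′ out

  ν-primeProduct-inside : ∀ a k → a < p → p ≤ a + k → ν p (primeProduct a k) ≡ 1
  ν-primeProduct-inside a zero    a<p p≤a+0 = contradiction (subst (p ≤_) (+-identityʳ a) p≤a+0) (<⇒≱ a<p)
  ν-primeProduct-inside a (suc k) a<p p≤a+1+k = trans (ν-primeProduct-suc a k) lastOrEarlier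
    where
    lastOrEarlier : ν p (primeProduct a k) + ν p (primeOr1 (a + suc k)) ≡ 1
    lastOrEarlier with a + suc k ≟ p
    ... | yes refl    = cong₂ _+_ (ν-primeProduct-outside a k (inj₂ (+-monoʳ-< a (n<1+n k))))
                                  (trans (cong (ν p) (primeOr1-prime pp)) (ν[p]≡1 1<p))
    ... | no  a+1+k≢p = cong₂ _+_ (ν-primeProduct-inside a k a<p p≤a+k) (ν-primeOr1-≢ a+1+k≢p)
      where
      p≤a+k : p ≤ a + k
      p≤a+k = s≤s⁻¹ (subst (p <_) (+-suc a k) (≤∧≢⇒< p≤a+1+k (a+1+k≢p ∘ sym)))

  ν-primeProduct≤1 : ∀ a k → ν p (primeProduct a k) ≤ 1
  ν-primeProduct≤1 a k with p ≤? a | a + k <? p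
  ... | yes p≤a | _         = subst (_≤ 1) (sym (ν-primeProduct-outside a k (inj₁ p≤a))) z≤n
  ... | no  _   | yes a+k<p = subst (_≤ 1) (sym (ν-primeProduct-outside a k (inj₂ a+k<p))) z≤n
  ... | no  p≰a | no  a+k≮p = ≤-reflexive (ν-primeProduct-inside a k (≰⇒> p≰a) (≮⇒≥ a+k≮p))

  ν≤ν-primePowerPart : ∀ s x → p ≤ s → ν p x ≤ ν p (primePowerPart s x)
  ν≤ν-primePowerPart zero    x p≤0 = contradiction (≤-trans p≤0 z≤n) (<⇒≱ 1<p)
  ν≤ν-primePowerPart (suc q) x p≤1+q with suc q ≟ p
  ... | yes refl = begin
    ν p x                           ≡⟨ ν[p^k]≡k (ν p x) 1<p ⟨
    ν p (p ^ ν p x)                 ≡⟨ cong (λ y → ν p (y ^ ν p x)) (primeOr1-prime pp) ⟨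
    ν p (primeOr1 p ^ ν p x)        ≤⟨ ν-mono-∣ 1<p {{primePowerPart≢0 (suc q) x}} (n∣m*n (primePowerPart q x)) ⟩
    ν p (primePowerPart (suc q) x)  ∎
    where open ≤-Reasoning
  ... | no  1+q≢p = ≤-trans (ν≤ν-primePowerPart q x p≤q)
    (ν-mono-∣ {x = primePowerPart q x} 1<p {{primePowerPart≢0 (suc q) x}} (m∣m*n (primeOr1 (suc q) ^ ν (suc q) x)))
    where
    p≤q : p ≤ q
    p≤q = s≤s⁻¹ (≤∧≢⇒< p≤1+q (1+q≢p ∘ sym))

primeProduct∣C[2k+1,k] : ∀ k → primeProduct (suc k) k ∣ (k + suc k) C k
primeProduct∣C[2k+1,k] k = ν-≤⇒∣ _ _ {{primeProduct≢0 (suc k) k}} {{C≢0 k (suc k)}} ν≤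
  where
  vanishes : ∀ {p} → Prime p → p ≤ suc k ⊎ suc k + k < p → ν p (primeProduct (suc k) k) ≤ ν p ((k + suc k) C k)
  vanishes pp out = ≤-trans (≤-reflexive (ν-primeProduct-outside pp (suc k) k out)) z≤n
  ν≤ : ∀ {p} → Prime p → ν p (primeProduct (suc k) k) ≤ ν p ((k + suc k) C k)
  ν≤ {p} pp with suc k <? p | p ≤? suc k + k
  ... | yes 1+k<p | yes p≤1+k+k = ≤-trans (ν-primeProduct≤1 pp (suc k) k)
    (ν-C-middle≥1 pp k (suc k) (<-trans (n<1+n k) 1+k<p) 1+k<p (subst (p ≤_) (sym (+-suc k k)) p≤1+k+k))
  ... | no  1+k≮p | _           = vanishes pp (inj₁ (≮⇒≥ 1+k≮p))
  ... | yes _     | no  p≰1+k+k = vanishes pp (inj₂ (≰⇒> p≰1+k+k))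

even⊎odd : ∀ n → ∃[ k ] (n ≡ k + k ⊎ n ≡ suc (k + k))
even⊎odd zero    = 0 , inj₁ refl
even⊎odd (suc n) with even⊎odd n
... | k , inj₁ n≡k+k   = k , inj₂ (cong suc n≡k+k)
... | k , inj₂ n≡1+k+k = suc k , inj₁ (trans (cong suc n≡1+k+k) (cong suc (sym (+-suc k k))))

primorial≤4^n : ∀ n → primeProduct 0 n ≤ 4 ^ n
primorial≤4^n = <-rec _ bound
  where
  bound : ∀ n → (∀ {m} → m < n → primeProduct 0 m ≤ 4 ^ m) → primeProduct 0 n ≤ 4 ^ n
  bound n rec with even⊎odd n
  ... | zero  , inj₁ refl = ≤-refl
  ... | suc k , inj₁ refl = begin
    primeProduct 0 (k + suc k) * primeOr1 (suc k + suc k)  ≤⟨ *-mono-≤ (rec ≤-refl) (primeOr1[m+m]≤2 (suc k)) ⟩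
    4 ^ (k + suc k) * 2                                    ≤⟨ *-monoʳ-≤ (4 ^ (k + suc k)) (m≤m+n 2 2) ⟩
    4 ^ (k + suc k) * 4                                    ≡⟨ *-comm (4 ^ (k + suc k)) 4 ⟩
    4 ^ suc (k + suc k)                                    ∎
    where open ≤-Reasoning
  ... | zero  , inj₂ refl = s≤s z≤n
  ... | suc k , inj₂ refl = begin
    primeProduct 0 (suc (suc k) + suc k)
      ≡⟨ primeProduct-+ (suc (suc k)) (suc k) ⟩
    primeProduct 0 (suc (suc k)) * primeProduct (suc (suc k)) (suc k)
      ≤⟨ *-mono-≤ (rec (s≤s (s≤s (m≤n+m (suc k) k))))
                  (∣⇒≤ {{C≢0 (suc k) (suc (suc k))}} (primeProduct∣C[2k+1,k] (suc k))) ⟩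
    4 ^ suc (suc k) * ((suc k + suc (suc k)) C suc k)
      ≤⟨ *-monoʳ-≤ (4 ^ suc (suc k)) (C[2k+1,k]≤4^k (suc k)) ⟩
    4 ^ suc (suc k) * 4 ^ suc k
      ≡⟨ ^-distribˡ-+-* 4 (suc (suc k)) (suc k) ⟨
    4 ^ (suc (suc k) + suc k)
      ∎
    where open ≤-Reasoning

⌊6x⌋-⌊2x⌋-⌊4x⌋≤⌊3x⌋-⌊x⌋-⌊2x⌋ : ∀ t → 3 ≤ t → t < 14 →
                                t / 2 ∸ (t / 6 + t / 3) ≤ t / 4 ∸ (t / 12 + t / 6)
⌊6x⌋-⌊2x⌋-⌊4x⌋≤⌊3x⌋-⌊x⌋-⌊2x⌋ t 3≤t t<14 = toWitness {a? = allUpTo? check 14} _ t<14 3≤t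
  where
  check : ∀ t → Dec (3 ≤ t → t / 2 ∸ (t / 6 + t / 3) ≤ t / 4 ∸ (t / 12 + t / 6))
  check t = 3 ≤? t →-dec (t / 2 ∸ (t / 6 + t / 3) ≤? t / 4 ∸ (t / 12 + t / 6))

-- Every ⌊c r / p⌋ with c ∣ 12 is ⌊t / (12 / c)⌋ for t = ⌊12 r / p⌋, and the hypotheses put t in
-- [3, 13], so the comparison of the two valuations is the finite check above.
ν-C[6r,2r]≤ν-C[3r,r] : ∀ {p} r → Prime p → p ≤ 4 * r → 6 * r < 7 * p → 6 * r < p * p →
                       ν p ((2 * r + 2 * (2 * r)) C (2 * r)) ≤ ν p ((r + 2 * r) C r)
ν-C[6r,2r]≤ν-C[3r,r] {p} r pp p≤4r 6r<7p 6r<p² = begin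
  ν p ((2 * r + 2 * (2 * r)) C (2 * r))
    ≡⟨ ν≡ (2 * r) (2 * (2 * r)) (subst (_< p * p) (sym (6r≡ r)) 6r<p²) ⟩
  (2 * r + 2 * (2 * r)) / p ∸ (2 * r / p + 2 * (2 * r) / p)
    ≡⟨ cong₂ _∸_ (via 2 (2 * r + 2 * (2 * r)) (2*[2r+2*2r]≡ r))
                 (cong₂ _+_ (via 6 (2 * r) (6*2r≡ r)) (via 3 (2 * (2 * r)) (3*[2*2r]≡ r))) ⟩
  t / 2 ∸ (t / 6 + t / 3)
    ≤⟨ ⌊6x⌋-⌊2x⌋-⌊4x⌋≤⌊3x⌋-⌊x⌋-⌊2x⌋ t 3≤t t<14 ⟩
  t / 4 ∸ (t / 12 + t / 6)
    ≡⟨ cong₂ _∸_ (via 4 (r + 2 * r) (4*[r+2r]≡ r))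
                 (cong₂ _+_ (via 12 r refl) (via 6 (2 * r) (6*2r≡ r))) ⟨
  (r + 2 * r) / p ∸ (r / p + 2 * r / p)
    ≡⟨ ν≡ r (2 * r) 3r<p² ⟨
  ν p ((r + 2 * r) C r)
    ∎
  where
  open ≤-Reasoning
  instance _ = prime⇒nonZero pp
  t = 12 * r / p
  via : ∀ k x .{{_ : NonZero k}} → k * x ≡ 12 * r → x / p ≡ t / k
  via k x kx≡12r = trans (sym ([k*m]/n/k≡m/n k x p)) (cong (λ y → y / p / k) kx≡12r)
  ν≡ : ∀ a b → a + b < p * p → ν p ((a + b) C a) ≡ (a + b) / p ∸ (a / p + b / p)
  ν≡ a b a+b<p² = trans (sym (m+n∸n≡m _ (a / p + b / p))) (cong (_∸ (a / p + b / p)) (ν-C-large pp a b a+b<p²))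
  6r≡ : ∀ r → 2 * r + 2 * (2 * r) ≡ 6 * r
  6r≡ = solve-∀
  3r≡ : ∀ r → r + 2 * r ≡ 3 * r
  3r≡ = solve-∀
  3*4r≡ : ∀ r → 3 * (4 * r) ≡ 12 * r
  3*4r≡ = solve-∀
  2*6r≡ : ∀ r → 2 * (6 * r) ≡ 12 * r
  2*6r≡ = solve-∀
  2*7p≡ : ∀ p → 2 * (7 * p) ≡ 14 * p
  2*7p≡ = solve-∀
  2*[2r+2*2r]≡ : ∀ r → 2 * (2 * r + 2 * (2 * r)) ≡ 12 * r
  2*[2r+2*2r]≡ = solve-∀
  3*[2*2r]≡ : ∀ r → 3 * (2 * (2 * r)) ≡ 12 * r
  3*[2*2r]≡ = solve-∀
  4*[r+2r]≡ : ∀ r → 4 * (r + 2 * r) ≡ 12 * r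
  4*[r+2r]≡ = solve-∀
  6*2r≡ : ∀ r → 6 * (2 * r) ≡ 12 * r
  6*2r≡ = solve-∀
  3r<p² : r + 2 * r < p * p
  3r<p² = ≤-<-trans (subst (_≤ 6 * r) (sym (3r≡ r)) (*-monoˡ-≤ r (m≤m+n 3 3))) 6r<p²
  3≤t : 3 ≤ t
  3≤t = m*n≤o⇒m≤o/n 3 (subst (3 * p ≤_) (3*4r≡ r) (*-monoʳ-≤ 3 p≤4r))
  t<14 : t < 14
  t<14 = m<n*o⇒m/o<n (subst₂ _<_ (2*6r≡ r) (2*7p≡ p) (*-monoʳ-< 2 6r<7p))

4^j≤r<4^[1+j] : ∀ r → 1 ≤ r → ∃[ j ] 4 ^ j ≤ r × r < 4 ^ suc j
4^j≤r<4^[1+j] (suc zero)    _ = 0 , ≤-refl , s≤s (s≤s z≤n)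
4^j≤r<4^[1+j] (suc (suc r)) _ with 4^j≤r<4^[1+j] (suc r) (s≤s z≤n)
... | j , 4^j≤1+r , 1+r<4^[1+j] with suc (suc r) <? 4 ^ suc j
...   | yes 2+r<4^[1+j] = j , m≤n⇒m≤1+n 4^j≤1+r , 2+r<4^[1+j]
...   | no  2+r≮4^[1+j] =
  suc j , ≤-reflexive (sym 2+r≡4^[1+j]) , subst (_< 4 ^ suc (suc j)) (sym 2+r≡4^[1+j]) 4^[1+j]<4^[2+j]
  where
  2+r≡4^[1+j] : suc (suc r) ≡ 4 ^ suc j
  2+r≡4^[1+j] = ≤-antisym 1+r<4^[1+j] (≮⇒≥ 2+r≮4^[1+j])
  4^[1+j]<4^[2+j] : 4 ^ suc j < 4 ^ suc (suc j)
  4^[1+j]<4^[2+j] = ^-monoʳ-< 4 (s≤s (s≤s z≤n)) (n<1+n (suc j))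

[2j+5]*[5*2^j+7]≤4^j : ∀ j → 7 ≤ j → (2 * j + 5) * (5 * 2 ^ j + 7) ≤ 4 ^ j
[2j+5]*[5*2^j+7]≤4^j j 7≤j =
  subst (λ j → (2 * j + 5) * (5 * 2 ^ j + 7) ≤ 4 ^ j) (m+[n∸m]≡n 7≤j) (from7 (j ∸ 7))
  where
  slack : ∀ j Z → 4 * ((2 * j + 5) * (5 * Z + 7))
                  ≡ (2 * suc j + 5) * (5 * (2 * Z) + 7) + (20 * j * Z + 42 * j + 30 * Z + 91)
  slack = solve-∀
  from7 : ∀ d → (2 * (7 + d) + 5) * (5 * 2 ^ (7 + d) + 7) ≤ 4 ^ (7 + d)
  from7 zero    = ≤ᵇ⇒≤ _ _ _
  from7 (suc d) = begin
    (2 * suc (7 + d) + 5) * (5 * (2 * 2 ^ (7 + d)) + 7)        ≤⟨ m≤m+n _ _ ⟩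
    (2 * suc (7 + d) + 5) * (5 * (2 * 2 ^ (7 + d)) + 7) + _     ≡⟨ slack (7 + d) (2 ^ (7 + d)) ⟨
    4 * ((2 * (7 + d) + 5) * (5 * 2 ^ (7 + d) + 7))             ≤⟨ *-monoʳ-≤ 4 (from7 d) ⟩
    4 * 4 ^ (7 + d)                                             ∎
    where open ≤-Reasoning

-- s = 5 · 2^j, for 4^j ≤ r < 4^(j + 1), is a crude upper bound for √(6r).
cutoff : ∀ r → 4 ^ 7 ≤ r → ∃[ s ] 6 * r < suc s * suc s × (6 * r) ^ (7 + s) ≤ 2 ^ r
cutoff r 4^7≤r with 4^j≤r<4^[1+j] r (≤-trans (m^n>0 4 7) 4^7≤r)
... | j , 4^j≤r , r<4^[1+j] = 5 * Z , 6r<[1+s]² , [6r]^[7+s]≤2^r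
  where
  open ≤-Reasoning
  Z = 2 ^ j
  4^j≡Z*Z : 4 ^ j ≡ Z * Z
  4^j≡Z*Z = trans (^-*-assoc 2 2 j) (trans (cong (2 ^_) (cong (j +_) (+-identityʳ j))) (^-distribˡ-+-* 2 j j))
  6r<24Z² : 6 * r < 24 * (Z * Z)
  6r<24Z² = begin-strict
    6 * r               <⟨ *-monoʳ-< 6 r<4^[1+j] ⟩
    6 * (4 * 4 ^ j)     ≡⟨ cong (λ x → 6 * (4 * x)) 4^j≡Z*Z ⟩
    6 * (4 * (Z * Z))   ≡⟨ *-assoc 6 4 (Z * Z) ⟨
    24 * (Z * Z)        ∎
  square : ∀ Z → suc (5 * Z) * suc (5 * Z) ≡ 24 * (Z * Z) + (Z * Z + 10 * Z + 1)
  square = solve-∀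
  6r<[1+s]² : 6 * r < suc (5 * Z) * suc (5 * Z)
  6r<[1+s]² = <-≤-trans 6r<24Z² (subst (24 * (Z * Z) ≤_) (sym (square Z)) (m≤m+n _ _))
  6r≤2^[2j+5] : 6 * r ≤ 2 ^ (2 * j + 5)
  6r≤2^[2j+5] = begin
    6 * r                   ≤⟨ <⇒≤ 6r<24Z² ⟩
    24 * (Z * Z)            ≤⟨ *-monoˡ-≤ (Z * Z) (m≤m+n 24 8) ⟩
    32 * (Z * Z)            ≡⟨ *-comm 32 (Z * Z) ⟩
    Z * Z * 32              ≡⟨ cong (_* 32) (trans (sym 4^j≡Z*Z) (^-*-assoc 2 2 j)) ⟩
    2 ^ (2 * j) * 2 ^ 5     ≡⟨ ^-distribˡ-+-* 2 (2 * j) 5 ⟨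
    2 ^ (2 * j + 5)         ∎
  7≤j : 7 ≤ j
  7≤j = ≮⇒≥ (λ j<7 → <⇒≱ (<-≤-trans r<4^[1+j] (^-monoʳ-≤ 4 j<7)) 4^7≤r)
  [6r]^[7+s]≤2^r : (6 * r) ^ (7 + 5 * Z) ≤ 2 ^ r
  [6r]^[7+s]≤2^r = begin
    (6 * r) ^ (7 + 5 * Z)                ≤⟨ ^-monoˡ-≤ (7 + 5 * Z) 6r≤2^[2j+5] ⟩
    (2 ^ (2 * j + 5)) ^ (7 + 5 * Z)      ≡⟨ ^-*-assoc 2 (2 * j + 5) (7 + 5 * Z) ⟩
    2 ^ ((2 * j + 5) * (7 + 5 * Z))      ≡⟨ cong (λ x → 2 ^ ((2 * j + 5) * x)) (+-comm 7 (5 * Z)) ⟩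
    2 ^ ((2 * j + 5) * (5 * Z + 7))      ≤⟨ ^-monoʳ-≤ 2 ([2j+5]*[5*2^j+7]≤4^j j 7≤j) ⟩
    2 ^ (4 ^ j)                          ≤⟨ ^-monoʳ-≤ 2 4^j≤r ⟩
    2 ^ r                                ∎

2^[3r+2K]<27^r : ∀ r K → 0 < r → 7 * K ≤ 6 * r → 2 ^ (3 * r + 2 * K) < 27 ^ r
2^[3r+2K]<27^r r K 0<r 7K≤6r = ≰⇒> (λ 27^r≤2^[3r+2K] → <⇒≱ (^-monoˡ-< r {{>-nonZero 0<r}} 2^33<27^7) (begin
  (27 ^ 7) ^ r                 ≡⟨ ^-*-assoc 27 7 r ⟩
  27 ^ (7 * r)                 ≡⟨ cong (27 ^_) (*-comm 7 r) ⟩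
  27 ^ (r * 7)                 ≡⟨ ^-*-assoc 27 r 7 ⟨
  (27 ^ r) ^ 7                 ≤⟨ ^-monoˡ-≤ 7 27^r≤2^[3r+2K] ⟩
  (2 ^ (3 * r + 2 * K)) ^ 7    ≡⟨ ^-*-assoc 2 (3 * r + 2 * K) 7 ⟩
  2 ^ ((3 * r + 2 * K) * 7)    ≤⟨ ^-monoʳ-≤ 2 exponent ⟩
  2 ^ (33 * r)                 ≡⟨ ^-*-assoc 2 33 r ⟨
  (2 ^ 33) ^ r                 ∎))
  where
  open ≤-Reasoning
  2^33<27^7 : 2 ^ 33 < 27 ^ 7
  2^33<27^7 = ≤ᵇ⇒≤ _ _ _
  expand : ∀ r K → (3 * r + 2 * K) * 7 ≡ 21 * r + 2 * (7 * K)
  expand = solve-∀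
  collect : ∀ r → 21 * r + 2 * (6 * r) ≡ 33 * r
  collect = solve-∀
  exponent : (3 * r + 2 * K) * 7 ≤ 33 * r
  exponent = begin
    (3 * r + 2 * K) * 7     ≡⟨ expand r K ⟩
    21 * r + 2 * (7 * K)    ≤⟨ +-monoʳ-≤ (21 * r) (*-monoʳ-≤ 2 7K≤6r) ⟩
    21 * r + 2 * (6 * r)    ≡⟨ collect r ⟩
    33 * r                  ∎

4^[2r]*2^r*4^K≡4^r*2^[3r+2K] : ∀ r K → 4 ^ (2 * r) * (2 ^ r * 4 ^ K) ≡ 4 ^ r * 2 ^ (3 * r + 2 * K)
4^[2r]*2^r*4^K≡4^r*2^[3r+2K] r K = begin
  4 ^ (2 * r) * (2 ^ r * 4 ^ K)                ≡⟨ cong₂ (λ a b → a * (2 ^ r * b)) (4^≡2^ (2 * r)) (4^≡2^ K) ⟩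
  2 ^ (2 * (2 * r)) * (2 ^ r * 2 ^ (2 * K))    ≡⟨ cong (2 ^ (2 * (2 * r)) *_) (^-distribˡ-+-* 2 r (2 * K)) ⟨
  2 ^ (2 * (2 * r)) * 2 ^ (r + 2 * K)          ≡⟨ ^-distribˡ-+-* 2 (2 * (2 * r)) (r + 2 * K) ⟨
  2 ^ (2 * (2 * r) + (r + 2 * K))              ≡⟨ cong (2 ^_) (exponent r K) ⟩
  2 ^ (2 * r + (3 * r + 2 * K))                ≡⟨ ^-distribˡ-+-* 2 (2 * r) (3 * r + 2 * K) ⟩
  2 ^ (2 * r) * 2 ^ (3 * r + 2 * K)            ≡⟨ cong (_* 2 ^ (3 * r + 2 * K)) (4^≡2^ r) ⟨
  4 ^ r * 2 ^ (3 * r + 2 * K)                  ∎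
  where
  open ≡-Reasoning
  4^≡2^ : ∀ x → 4 ^ x ≡ 2 ^ (2 * x)
  4^≡2^ = ^-*-assoc 2 2
  exponent : ∀ r K → 2 * (2 * r) + (r + 2 * K) ≡ 2 * r + (3 * r + 2 * K)
  exponent = solve-∀

-- A prime in (4r, 6r − 5] for large r

module _ (r s : ℕ) (0<r : 0 < r) (6r<[1+s]² : 6 * r < suc s * suc s)
         (noPrime : ∀ {p} → Prime p → 4 * r < p → p + 5 ≤ 6 * r → ⊥) where

  private
    m = 2 * r
    B = (m + 2 * m) C m
    C₃ = (r + 2 * r) C r
    K = 6 * r / 7
    Q = primeProduct (6 * r ∸ 6) 6
    W = primePowerPart s B
    P = primeProduct 0 K
    R = Q * W * C₃ * P
    R≢0 : NonZero R
    R≢0 = m*n≢0 (Q * W * C₃) P {{m*n≢0 (Q * W) C₃ {{QW≢0}} {{C≢0 r (2 * r)}}}} {{primeProduct≢0 0 K}}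
      where QW≢0 = m*n≢0 Q W {{primeProduct≢0 (6 * r ∸ 6) 6}} {{primePowerPart≢0 s B}}

    6≤6r : 6 ≤ 6 * r
    6≤6r = *-monoʳ-≤ 6 0<r

    m+2m≡6r : m + 2 * m ≡ 6 * r
    m+2m≡6r = 2r+2*2r≡6r r
      where
      2r+2*2r≡6r : ∀ r → 2 * r + 2 * (2 * r) ≡ 6 * r
      2r+2*2r≡6r = solve-∀

    Q∣R : Q ∣ R
    Q∣R = ∣m⇒∣m*n P (∣m⇒∣m*n C₃ (∣m⇒∣m*n W ∣-refl))
    W∣R : W ∣ R
    W∣R = ∣m⇒∣m*n P (∣m⇒∣m*n C₃ (n∣m*n Q))
    C₃∣R : C₃ ∣ R
    C₃∣R = ∣m⇒∣m*n P (n∣m*n (Q * W))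
    P∣R : P ∣ R
    P∣R = n∣m*n (Q * W * C₃)

  ν-B≤1 : ∀ {p} → Prime p → 6 * r < p * p → ν p B ≤ 1
  ν-B≤1 {p} pp 6r<p² = ν-C-large≤1 pp m (2 * m) (subst (_< p * p) (sym m+2m≡6r) 6r<p²)

  ν-B≤ν-R-large : ∀ {p} → Prime p → 6 * r < p * p → ν p B ≤ ν p R
  ν-B≤ν-R-large {p} pp 6r<p² with 6 * r <? p | 7 * p ≤? 6 * r | 4 * r <? p
  ... | yes 6r<p | _         | _       = subst (_≤ ν p R) (sym (ν-C≡0 pp m (2 * m) (subst (_< p) (sym m+2m≡6r) 6r<p))) z≤n
  ... | no  _    | yes 7p≤6r | _       = begin
    ν p B       ≤⟨ ν-B≤1 pp 6r<p² ⟩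
    1           ≡⟨ ν-primeProduct-inside pp 0 K (<-trans z<s (prime⇒1<p pp)) p≤K ⟨
    ν p P       ≤⟨ ν-mono-∣ (prime⇒1<p pp) {{R≢0}} P∣R ⟩
    ν p R       ∎
    where
    open ≤-Reasoning
    p≤K : p ≤ K
    p≤K = m*n≤o⇒m≤o/n p (subst (_≤ 6 * r) (*-comm 7 p) 7p≤6r)
  ... | no  _    | no  7p≰6r | no 4r≮p = begin
    ν p B       ≤⟨ ν-C[6r,2r]≤ν-C[3r,r] r pp (≮⇒≥ 4r≮p) (≰⇒> 7p≰6r) 6r<p² ⟩
    ν p C₃      ≤⟨ ν-mono-∣ (prime⇒1<p pp) {{R≢0}} C₃∣R ⟩
    ν p R       ∎
    where open ≤-Reasoning
  ... | no  6r≮p | no  _     | yes 4r<p = begin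
    ν p B       ≤⟨ ν-B≤1 pp 6r<p² ⟩
    1           ≡⟨ ν-primeProduct-inside pp (6 * r ∸ 6) 6 6r-6<p p≤6r-6+6 ⟨
    ν p Q       ≤⟨ ν-mono-∣ (prime⇒1<p pp) {{R≢0}} Q∣R ⟩
    ν p R       ∎
    where
    open ≤-Reasoning
    6r<p+6 : 6 * r < p + 6
    6r<p+6 = subst (6 * r <_) (sym (+-suc p 5)) (m<n⇒m<1+n (≰⇒> (noPrime pp 4r<p)))
    6r-6<p : 6 * r ∸ 6 < p
    6r-6<p = +-cancelʳ-< 6 (6 * r ∸ 6) p (subst (_< p + 6) (sym (m∸n+n≡m 6≤6r)) 6r<p+6)
    p≤6r-6+6 : p ≤ 6 * r ∸ 6 + 6
    p≤6r-6+6 = subst (p ≤_) (sym (m∸n+n≡m 6≤6r)) (≮⇒≥ 6r≮p)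

  ν-B≤ν-R : ∀ {p} → Prime p → ν p B ≤ ν p R
  ν-B≤ν-R {p} pp with p ≤? s
  ... | yes p≤s = ≤-trans (ν≤ν-primePowerPart pp s B p≤s) (ν-mono-∣ (prime⇒1<p pp) {{R≢0}} W∣R)
  ... | no  p≰s = ν-B≤ν-R-large pp (<-≤-trans 6r<[1+s]² (*-mono-≤ (≰⇒> p≰s) (≰⇒> p≰s)))

  27^r≤2^[3r+2K] : (6 * r) ^ (7 + s) ≤ 2 ^ r → 27 ^ r ≤ 2 ^ (3 * r + 2 * K)
  27^r≤2^[3r+2K] Y≤2^r = *-cancelˡ-≤ (27 ^ r * 4 ^ r) {{m*n≢0 _ _ {{m^n≢0 27 r}} {{m^n≢0 4 r}}}} (begin
    27 ^ r * 4 ^ r * 27 ^ r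
      ≡⟨ regroup₁ (27 ^ r) (4 ^ r) ⟩
    27 ^ r * 27 ^ r * 4 ^ r
      ≡⟨ cong (_* 4 ^ r) 27^r*27^r≡27^m ⟩
    27 ^ m * 4 ^ r
      ≤⟨ *-monoˡ-≤ (4 ^ r) (27^m≤[2m+1]*4^m*C[3m,m] m) ⟩
    (2 * m + 1) * (4 ^ m * B) * 4 ^ r
      ≤⟨ *-monoˡ-≤ (4 ^ r) (*-mono-≤ 2m+1≤6r (*-monoʳ-≤ (4 ^ m) B≤R)) ⟩
    6 * r * (4 ^ m * R) * 4 ^ r
      ≡⟨ regroup₂ (6 * r) (4 ^ m) Q W C₃ P (4 ^ r) ⟩
    4 ^ m * (6 * r * (Q * W) * P) * (4 ^ r * C₃)
      ≤⟨ *-mono-≤ (*-monoʳ-≤ (4 ^ m) (*-mono-≤ (*-monoʳ-≤ (6 * r) (*-mono-≤ Q≤X^6 W≤X^s)) (primorial≤4^n K)))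
                  (4^m*C[3m,m]≤27^m r) ⟩
    4 ^ m * (6 * r * ((6 * r) ^ 6 * (6 * r) ^ s) * 4 ^ K) * 27 ^ r
      ≡⟨ cong (λ y → 4 ^ m * (6 * r * y * 4 ^ K) * 27 ^ r) (^-distribˡ-+-* (6 * r) 6 s) ⟨
    4 ^ m * ((6 * r) ^ (7 + s) * 4 ^ K) * 27 ^ r
      ≤⟨ *-monoˡ-≤ (27 ^ r) (*-monoʳ-≤ (4 ^ m) (*-monoˡ-≤ (4 ^ K) Y≤2^r)) ⟩
    4 ^ m * (2 ^ r * 4 ^ K) * 27 ^ r
      ≡⟨ cong (_* 27 ^ r) (4^[2r]*2^r*4^K≡4^r*2^[3r+2K] r K) ⟩
    4 ^ r * 2 ^ (3 * r + 2 * K) * 27 ^ r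
      ≡⟨ regroup₃ (4 ^ r) (2 ^ (3 * r + 2 * K)) (27 ^ r) ⟩
    27 ^ r * 4 ^ r * 2 ^ (3 * r + 2 * K)
      ∎)
    where
    open ≤-Reasoning
    regroup₁ : ∀ a b → a * b * a ≡ a * a * b
    regroup₁ = solve-∀
    regroup₂ : ∀ x f q w c p g → x * (f * (q * w * c * p)) * g ≡ f * (x * (q * w) * p) * (g * c)
    regroup₂ = solve-∀
    regroup₃ : ∀ a b c → a * b * c ≡ c * a * b
    regroup₃ = solve-∀
    27^r*27^r≡27^m : 27 ^ r * 27 ^ r ≡ 27 ^ m
    27^r*27^r≡27^m = trans (sym (^-distribˡ-+-* 27 r r)) (cong (λ x → 27 ^ (r + x)) (sym (+-identityʳ r)))
    2m+1≤6r : 2 * m + 1 ≤ 6 * r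
    2m+1≤6r = subst (2 * m + 1 ≤_) (lemma r) (+-monoʳ-≤ (2 * m) (≤-trans 0<r (m≤m+n r _)))
      where
      lemma : ∀ r → 2 * (2 * r) + 2 * r ≡ 6 * r
      lemma = solve-∀
    B≤R : B ≤ R
    B≤R = ∣⇒≤ {{R≢0}} (ν-≤⇒∣ B R {{C≢0 m (2 * m)}} {{R≢0}} ν-B≤ν-R)
    Q≤X^6 : Q ≤ (6 * r) ^ 6
    Q≤X^6 = subst (λ x → Q ≤ x ^ 6) (m∸n+n≡m 6≤6r) (primeProduct≤ (6 * r ∸ 6) 6)
    W≤X^s : W ≤ (6 * r) ^ s
    W≤X^s = primePowerPart≤ s B {6 * r} (≤-trans (s≤s z≤n) 6≤6r) q^ν≤6r
      where
      m+2m-positive : 0 < m + 2 * m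
      m+2m-positive = subst (0 <_) (sym m+2m≡6r) (≤-trans (s≤s z≤n) 6≤6r)
      q^ν≤6r : ∀ {q} → Prime q → q ^ ν q B ≤ 6 * r
      q^ν≤6r {q} pq = subst (q ^ ν q B ≤_) m+2m≡6r (p^ν[C]≤ pq m (2 * m) m+2m-positive)

prime-between-4r-and-6r : ∀ r → 4 ^ 7 ≤ r → ∃[ p ] Prime p × 4 * r < p × p + 5 ≤ 6 * r
prime-between-4r-and-6r r 4^7≤r = forget-bound (decidable-stable (anyUpTo? between? (6 * r)) ¬∄p)
  where
  Between : ℕ → Set
  Between p = Prime p × 4 * r < p × p + 5 ≤ 6 * r
  between? : ∀ p → Dec (Between p)
  between? p = prime? p ×-dec (4 * r <? p ×-dec p + 5 ≤? 6 * r)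
  forget-bound : (∃[ p ] p < 6 * r × Between p) → ∃[ p ] Between p
  forget-bound (p , _ , between) = p , between
  0<r : 0 < r
  0<r = ≤-trans (m^n>0 4 7) 4^7≤r
  ¬∄p : ¬ ¬ (∃[ p ] p < 6 * r × Between p)
  ¬∄p ∄p = absurd-with (cutoff r 4^7≤r)
    where
    noPrime : ∀ {p} → Prime p → 4 * r < p → p + 5 ≤ 6 * r → ⊥
    noPrime {p} pp 4r<p p+5≤6r = ∄p (p , <-≤-trans (m<m+n p z<s) p+5≤6r , pp , 4r<p , p+5≤6r)
    absurd-with : (∃[ s ] 6 * r < suc s * suc s × (6 * r) ^ (7 + s) ≤ 2 ^ r) → ⊥
    absurd-with (s , 6r<[1+s]² , [6r]^[7+s]≤2^r) = contradiction
      (27^r≤2^[3r+2K] r s 0<r 6r<[1+s]² noPrime [6r]^[7+s]≤2^r)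
      (<⇒≱ (2^[3r+2K]<27^r r (6 * r / 7) 0<r (subst (_≤ 6 * r) (*-comm (6 * r / 7) 7) (m/n*n≤m (6 * r) 7))))

ThreeHalvesPrime : ℕ → Set
ThreeHalvesPrime N = ∃[ p ] Prime p × N < p × 2 * p < 3 * N

threeHalvesPrime-large : ∀ N → 4 ^ 8 ≤ N → ThreeHalvesPrime N
threeHalvesPrime-large N 4^8≤N =
  fromQuarter (prime-between-4r-and-6r r (m*n≤o⇒m≤o/n (4 ^ 7) (≤-trans 4^8≤N (m≤m+n N 3))))
  where
  r = (N + 3) / 4
  4r≤N+3 : 4 * r ≤ N + 3
  4r≤N+3 = subst (_≤ N + 3) (*-comm r 4) (m/n*n≤m (N + 3) 4)
  N≤4r : N ≤ 4 * r
  N≤4r = +-cancelʳ-≤ 4 N (4 * r) (subst₂ _≤_ (sym (+-suc N 3)) (+-comm 4 (4 * r)) N+3<4+4r)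
    where
    N+3<4+4r : N + 3 < 4 + 4 * r
    N+3<4+4r = subst (N + 3 <_) (cong (4 +_) (*-comm r 4)) (m<[1+m/n]*n (N + 3) 4)
  fromQuarter : (∃[ p ] Prime p × 4 * r < p × p + 5 ≤ 6 * r) → ThreeHalvesPrime N
  fromQuarter (p , pp , 4r<p , p+5≤6r) = p , pp , ≤-<-trans N≤4r 4r<p , 2p<3N
    where
    open ≤-Reasoning
    rearrange₁ : ∀ p → suc (2 * p) + 9 ≡ 2 * (p + 5)
    rearrange₁ = solve-∀
    rearrange₂ : ∀ r → 2 * (6 * r) ≡ 3 * (4 * r)
    rearrange₂ = solve-∀
    rearrange₃ : ∀ N → 3 * (N + 3) ≡ 3 * N + 9
    rearrange₃ = solve-∀
    2p<3N : 2 * p < 3 * N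
    2p<3N = +-cancelʳ-≤ 9 (suc (2 * p)) (3 * N) (begin
      suc (2 * p) + 9     ≡⟨ rearrange₁ p ⟩
      2 * (p + 5)         ≤⟨ *-monoʳ-≤ 2 p+5≤6r ⟩
      2 * (6 * r)         ≡⟨ rearrange₂ r ⟩
      3 * (4 * r)         ≤⟨ *-monoʳ-≤ 3 4r≤N+3 ⟩
      3 * (N + 3)         ≡⟨ rearrange₃ N ⟩
      3 * N + 9           ∎)

noFactorFrom : ℕ → ℕ → ℕ → Bool
noFactorFrom zero       n k = false
noFactorFrom (suc fuel) n k = (n <ᵇ (2 + k) * (2 + k)) ∨ (not (n % (2 + k) ≡ᵇ 0) ∧ noFactorFrom fuel n (suc k))

noFactorFrom-sound : ∀ fuel n k → .{{NonTrivial n}} → (2 + k) Rough n → T (noFactorFrom fuel n k) → Prime n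
noFactorFrom-sound (suc fuel) n k rough check with Equivalence.to T-∨ check
... | inj₁ n<[2+k]² = rough∧square>⇒prime rough (<ᵇ⇒< n _ n<[2+k]²)
... | inj₂ rest with Equivalence.to T-∧ rest
...   | 2+k∤n , check′ = noFactorFrom-sound fuel n (suc k) (∤⇒rough-suc 2+k∤n′ rough) check′
  where
  2+k∤n′ : 2 + k ∤ n
  2+k∤n′ 2+k∣n = subst T (cong not (≡ᵇ-true (n∣m⇒m%n≡0 n (2 + k) 2+k∣n))) 2+k∤n
    where
    ≡ᵇ-true : ∀ {x} → x ≡ 0 → (x ≡ᵇ 0) ≡ true
    ≡ᵇ-true refl = refl

isPrime : ℕ → Bool
isPrime n = (1 <ᵇ n) ∧ noFactorFrom n n 0

isPrime-sound : ∀ n → T (isPrime n) → Prime n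
isPrime-sound n check with Equivalence.to T-∧ check
... | 1<n , noFactor = noFactorFrom-sound n n 0 {{n>1⇒nonTrivial (<ᵇ⇒< 1 n 1<n)}} 2-rough noFactor

primeLadder : ℕ → List ℕ → Bool
primeLadder a []       = true
primeLadder a (q ∷ qs) = isPrime q ∧ (2 * q <ᵇ 3 * a) ∧ primeLadder q qs

top : ℕ → List ℕ → ℕ
top a []       = a
top a (q ∷ qs) = top q qs

primeLadder-sound : ∀ a qs → T (primeLadder a qs) → ∀ {N} → a ≤ N → N < top a qs → ThreeHalvesPrime N
primeLadder-sound a []       _     a≤N N<a = contradiction a≤N (<⇒≱ N<a)
primeLadder-sound a (q ∷ qs) check {N} a≤N N<top with Equivalence.to T-∧ check
... | q-prime , rest with Equivalence.to T-∧ rest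
...   | 2q<3a , check′ with N <? q
...     | yes N<q = q , isPrime-sound q q-prime , N<q , <-≤-trans (<ᵇ⇒< _ _ 2q<3a) (*-monoʳ-≤ 3 a≤N)
...     | no  N≮q = primeLadder-sound q qs check′ (≮⇒≥ N≮q) N<top

threeHalvesPrime-small : ∀ N → 12 ≤ N → N < 80923 → ThreeHalvesPrime N
threeHalvesPrime-small N = primeLadder-sound 12
  (13 ∷ 19 ∷ 23 ∷ 31 ∷ 43 ∷ 61 ∷ 89 ∷ 131 ∷ 193 ∷ 283 ∷ 421 ∷ 631 ∷ 941 ∷ 1409 ∷ 2113 ∷ 3169 ∷
   4751 ∷ 7121 ∷ 10667 ∷ 15991 ∷ 23981 ∷ 35969 ∷ 53951 ∷ 80923 ∷ []) _

threeHalvesPrime : ∀ N → 12 ≤ N → ThreeHalvesPrime N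
threeHalvesPrime N 12≤N with N <? 80923
... | yes N<80923 = threeHalvesPrime-small N 12≤N N<80923
... | no  N≮80923 = threeHalvesPrime-large N (≤-trans (≤ᵇ⇒≤ (4 ^ 8) 80923 _) (≮⇒≥ N≮80923))

threeHalvesPrime-scale : ∀ a n .{{_ : NonZero a}} → ThreeHalvesPrime (n / a) →
                         ∃[ p ] Prime p × n < a * p × 2 * (a * p) < 3 * n
threeHalvesPrime-scale a n (p , pp , n/a<p , 2p<3[n/a]) = p , pp , n<ap , 2ap<3n
  where
  open ≤-Reasoning
  n<ap : n < a * p
  n<ap = begin-strict
    n                   <⟨ m<[1+m/n]*n n a ⟩
    suc (n / a) * a     ≤⟨ *-monoˡ-≤ a n/a<p ⟩
    p * a               ≡⟨ *-comm p a ⟩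
    a * p               ∎
  2ap<3n : 2 * (a * p) < 3 * n
  2ap<3n = begin-strict
    2 * (a * p)         ≡⟨ x∙yz≈y∙xz *-commutativeSemigroup 2 a p ⟩
    a * (2 * p)         <⟨ *-monoʳ-< a 2p<3[n/a] ⟩
    a * (3 * (n / a))   ≡⟨ x∙yz≈y∙xz *-commutativeSemigroup a 3 (n / a) ⟩
    3 * (a * (n / a))   ≤⟨ *-monoʳ-≤ 3 (subst (_≤ n) (*-comm (n / a) a) (m/n*n≤m n a)) ⟩
    3 * n               ∎

lemma6p2 : ∀ (a : ℕ) → 0 < a → ∀ (n : ℕ) → n > 12 * a → ∃ λ (p : ℕ) → Prime p × n < a * p × 2 * (a * p) < 3 * n
lemma6p2 a 0<a n 12a<n = threeHalvesPrime-scale a n (threeHalvesPrime (n / a) (m*n≤o⇒m≤o/n 12 (<⇒≤ 12a<n)))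
  where instance _ = >-nonZero 0<a
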